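{- Let $\varphi$ be an LTL formula over $V = I \cup O$, and suppose $\mathrm{isDependent}(z,Y)$ returns true if and only if $\{z\}$ is dependent on $Y$ in $\varphi$. Consider the procedure FindDependent: start with $X = \emptyset$; for each $z \in O$ in turn (each considered once, in some order), if $\mathrm{isDependent}(z, V \setminus (X \cup \{z\}))$ then set $X := X \cup \{z\}$; finally return $X$. Then FindDependent returns a maximal dependent set in $\varphi$.
   Context: Letters are assignments to $V$; $a.Z$ is the restriction of letter $a$ to $Z \subseteq V$; for an infinite word $w$, $w[0,i] = w_0\cdots w_i$ and $w[0,-1]$ is empty. $X \subseteq O$ is dependent on $Y$ in $\varphi$ if for all $w,w' \in L(\varphi)$ and $i\ge 0$, $w[0,i-1]=w'[0,i-1]$ and $w_i.Y=w'_i.Y$ imply $w_i.X = w'_i.X$; $X$ is dependent in $\varphi$ if it is dependent on $V\setminus X$; $X$ is a maximal dependent set in $\varphi$ if $X$ is dependent in $\varphi$ and no set $X' \subseteq O$ strictly containing $X$ is dependent in $\varphi$. -}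

module Defs where

open import Data.Nat using (ℕ; _<_; suc)
open import Data.Bool using (Bool; true; false; if_then_else_)
open import Data.Fin using (Fin)
open import Data.Fin.Subset using (Subset; _∈_; _⊆_; _⊂_; ∁; _∪_; ⁅_⁆; ⊥)
open import Data.List using (List; foldl)
open import Data.Product using (Σ; ∃; _×_; _,_)
open import Data.Sum using (_⊎_)
open import Data.Unit using (⊤)
open import Data.Empty renaming (⊥ to Empty)
open import Relation.Nullary using (¬_)
open import Relation.Binary.PropositionalEquality using (_≡_)

Letter : ℕ → Set
Letter n = Fin n → Bool

Word : ℕ → Set
Word n = ℕ → Letter n

-- LTL formulas over the propositional variables V = Fin n (core syntax;
-- the other operators are the usual abbreviations).
data LTL (n : ℕ) : Set where
  tt   : LTL n
  atom : Fin n → LTL n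
  ¬ₗ_  : LTL n → LTL n
  _∧ₗ_ : LTL n → LTL n → LTL n
  Xₗ   : LTL n → LTL n
  _Uₗ_ : LTL n → LTL n → LTL n

_,_⊨_ : ∀ {n} → Word n → ℕ → LTL n → Set
w , i ⊨ tt = ⊤
w , i ⊨ atom v = w i v ≡ true
w , i ⊨ (¬ₗ φ) = ¬ (w , i ⊨ φ)
w , i ⊨ (φ ∧ₗ ψ) = (w , i ⊨ φ) × (w , i ⊨ ψ)
w , i ⊨ Xₗ φ = w , suc i ⊨ φ
w , i ⊨ (φ Uₗ ψ) =
  ∃ λ k → (w , (k Data.Nat.+ i) ⊨ ψ) × (∀ j → j < k → w , (j Data.Nat.+ i) ⊨ φ)

InL : ∀ {n} → LTL n → Word n → Set
InL φ w = w , 0 ⊨ φ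

AgreeOn : ∀ {n} → Subset n → Letter n → Letter n → Set
AgreeOn Z a b = ∀ v → v ∈ Z → a v ≡ b v

PrefixEq : ∀ {n} → ℕ → Word n → Word n → Set
PrefixEq i w w' = ∀ j → j < i → ∀ v → w j v ≡ w' j v

DependentOn : ∀ {n} → LTL n → Subset n → Subset n → Set
DependentOn φ X Y =
  ∀ w w' i → InL φ w → InL φ w' → PrefixEq i w w' →
  AgreeOn Y (w i) (w' i) → AgreeOn X (w i) (w' i)

Dependent : ∀ {n} → LTL n → Subset n → Set
Dependent φ X = DependentOn φ X (∁ X)

MaximalDependent : ∀ {n} → LTL n → (O X : Subset n) → Set
MaximalDependent φ O X =
  X ⊆ O × Dependent φ X × (∀ X' → X' ⊆ O → X ⊂ X' → ¬ Dependent φ X')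

findDependent : ∀ {n} → (Fin n → Subset n → Bool) → List (Fin n) → Subset n
findDependent {n} isDep ord = foldl step ⊥ ord
  where
  step : Subset n → Fin n → Subset n
  step X z = if isDep z (∁ (X ∪ ⁅ z ⁆)) then X ∪ ⁅ z ⁆ else X

-- Dependence is monotone (fewer determined variables, more determining ones)
-- and composes: if Z is determined by Y, and X by Y together with Z, then
-- X ∪ Z is determined by Y.  Hence adding an accepted z to a dependent X
-- keeps it dependent, so FindDependent returns a dependent set.  For
-- maximality, an output z rejected against the current set X is also
-- rejected against every later, larger set; but any dependent X' ⊇ X with
-- z ∈ X' would make z dependent on ∁ (X ∪ ⁅ z ⁆), i.e. accepted.
module Submission where

open import Defs
open import Data.Nat using (ℕ)
open import Data.Bool using (Bool; true; false; if_then_else_)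
open import Data.Fin using (Fin)
open import Data.Fin.Subset using (Subset; _∈_; ⁅_⁆; _⊆_; _⊂_; ∁; _∪_; ⊥)
open import Data.Fin.Subset.Properties
open import Data.List using (List; []; _∷_; foldl)
open import Data.List.Relation.Unary.Unique.Propositional using (Unique)
open import Data.List.Membership.Propositional renaming (_∈_ to _∈ₗ_)
open import Data.List.Relation.Unary.Any using (here; there)
open import Data.Product using (_,_)
open import Data.Sum using (_⊎_; inj₁; inj₂; [_,_])
open import Data.Empty using (⊥-elim)
open import Function using (_∘_; id; case_of_)
open import Function.Bundles using (_⇔_; module Equivalence)
open import Relation.Nullary using (¬_; yes; no)
open import Relation.Binary.PropositionalEquality using (_≡_; refl; sym; trans; subst)

private
  variable
    n : ℕ
    p q r X Y Z X' Y' : Subset n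
    a b : Letter n

∪-least : p ⊆ r → q ⊆ r → p ∪ q ⊆ r
∪-least {p = p} {q = q} p⊆r q⊆r = [ p⊆r , q⊆r ] ∘ x∈p∪q⁻ p q

x∈p⇒⁅x⁆⊆p : ∀ {x : Fin n} → x ∈ p → ⁅ x ⁆ ⊆ p
x∈p⇒⁅x⁆⊆p {p = p} {x} x∈p y∈⁅x⁆ = subst (_∈ p) (sym (x∈⁅y⁆⇒x≡y x y∈⁅x⁆)) x∈p

∁p⊆∁[p∪q]∪q : ∁ p ⊆ ∁ (p ∪ q) ∪ q
∁p⊆∁[p∪q]∪q {p = p} {q = q} {x} x∈∁p with x ∈? q
... | yes x∈q = q⊆p∪q _ q x∈q
... | no  x∉q = p⊆p∪q q (x∉p⇒x∈∁p ([ x∈∁p⇒x∉p x∈∁p , x∉q ] ∘ x∈p∪q⁻ p q))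

AgreeOn-mono : X' ⊆ X → AgreeOn X a b → AgreeOn X' a b
AgreeOn-mono X'⊆X agree v = agree v ∘ X'⊆X

AgreeOn-∪ : AgreeOn X a b → AgreeOn Y a b → AgreeOn (X ∪ Y) a b
AgreeOn-∪ {X = X} {Y = Y} agreeX agreeY v = [ agreeX v , agreeY v ] ∘ x∈p∪q⁻ X Y

module _ (φ : LTL n) where

  DependentOn-mono : X' ⊆ X → Y ⊆ Y' → DependentOn φ X Y → DependentOn φ X' Y'
  DependentOn-mono X'⊆X Y⊆Y' dep w w' i w∈L w'∈L prefix agree =
    AgreeOn-mono X'⊆X (dep w w' i w∈L w'∈L prefix (AgreeOn-mono Y⊆Y' agree))

  DependentOn-⊥ : DependentOn φ ⊥ Y
  DependentOn-⊥ _ _ _ _ _ _ _ _ = ⊥-elim ∘ ∉⊥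

  DependentOn-∪ : DependentOn φ Z Y → DependentOn φ X (Y ∪ Z) → DependentOn φ (X ∪ Z) Y
  DependentOn-∪ {Z = Z} depZ depX w w' i w∈L w'∈L prefix agreeY =
    AgreeOn-∪ (depX w w' i w∈L w'∈L prefix (AgreeOn-∪ agreeY agreeZ)) agreeZ
    where
    agreeZ : AgreeOn Z (w i) (w' i)
    agreeZ = depZ w w' i w∈L w'∈L prefix agreeY

  Dependent-∪ : Dependent φ X → DependentOn φ Z (∁ (X ∪ Z)) → Dependent φ (X ∪ Z)
  Dependent-∪ depX depZ =
    DependentOn-∪ depZ (DependentOn-mono ⊆-refl ∁p⊆∁[p∪q]∪q depX)

  Accepts : Subset n → Fin n → Set
  Accepts X z = DependentOn φ ⁅ z ⁆ (∁ (X ∪ ⁅ z ⁆))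

  Accepts-antitone : ∀ {z} → X ⊆ Y → Accepts Y z → Accepts X z
  Accepts-antitone {X = X} {Y = Y} {z} X⊆Y =
    DependentOn-mono ⊆-refl (p⊆q⇒∁p⊇∁q (∪-least (p⊆p∪q ⁅ z ⁆ ∘ X⊆Y) (q⊆p∪q Y ⁅ z ⁆)))

  Dependent⇒Accepts : ∀ {z} → Dependent φ X' → X ⊆ X' → z ∈ X' → Accepts X z
  Dependent⇒Accepts depX' X⊆X' z∈X' =
    DependentOn-mono (x∈p⇒⁅x⁆⊆p z∈X') (p⊆q⇒∁p⊇∁q (∪-least X⊆X' (x∈p⇒⁅x⁆⊆p z∈X'))) depX'

module FindDependent (φ : LTL n) (isDependent : Fin n → Subset n → Bool)
  (isDependent-correct : ∀ z Y → (isDependent z Y ≡ true) ⇔ DependentOn φ ⁅ z ⁆ Y) where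

  -- Definitionally the step of findDependent, so findDependent isDependent ord is foldl step ⊥ ord.
  step : Subset n → Fin n → Subset n
  step X z = if isDependent z (∁ (X ∪ ⁅ z ⁆)) then X ∪ ⁅ z ⁆ else X

  ⊆-step : ∀ z → X ⊆ step X z
  ⊆-step {X = X} z with isDependent z (∁ (X ∪ ⁅ z ⁆))
  ... | true  = p⊆p∪q ⁅ z ⁆
  ... | false = ⊆-refl

  step-⊆ : ∀ z → step X z ⊆ X ∪ ⁅ z ⁆
  step-⊆ {X = X} z with isDependent z (∁ (X ∪ ⁅ z ⁆))
  ... | true  = ⊆-refl
  ... | false = p⊆p∪q ⁅ z ⁆

  step-preserves-Dependent : ∀ z → Dependent φ X → Dependent φ (step X z)
  step-preserves-Dependent {X = X} z depX with isDependent z (∁ (X ∪ ⁅ z ⁆)) in accepted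
  ... | true  = Dependent-∪ φ depX (Equivalence.to (isDependent-correct z _) accepted)
  ... | false = depX

  step-decides : ∀ z → z ∈ step X z ⊎ ¬ Accepts φ X z
  step-decides {X = X} z with isDependent z (∁ (X ∪ ⁅ z ⁆)) in rejected
  ... | true  = inj₁ (q⊆p∪q X ⁅ z ⁆ (x∈⁅x⁆ z))
  ... | false = inj₂ λ accepts →
    case trans (sym rejected) (Equivalence.from (isDependent-correct z _) accepts) of λ ()

  ⊆-foldl : ∀ ord → X ⊆ foldl step X ord
  ⊆-foldl []        = ⊆-refl
  ⊆-foldl (z ∷ ord) = ⊆-foldl ord ∘ ⊆-step z

  foldl-⊆ : ∀ {x} ord → x ∈ foldl step X ord → x ∈ X ⊎ x ∈ₗ ord
  foldl-⊆ [] x∈ = inj₁ x∈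
  foldl-⊆ {X = X} (z ∷ ord) x∈ with foldl-⊆ ord x∈
  ... | inj₂ x∈ord  = inj₂ (there x∈ord)
  ... | inj₁ x∈step with x∈p∪q⁻ X ⁅ z ⁆ (step-⊆ z x∈step)
  ...   | inj₁ x∈X = inj₁ x∈X
  ...   | inj₂ x∈z = inj₂ (here (x∈⁅y⁆⇒x≡y z x∈z))

  foldl-preserves-Dependent : ∀ ord → Dependent φ X → Dependent φ (foldl step X ord)
  foldl-preserves-Dependent []        = id
  foldl-preserves-Dependent (z ∷ ord) = foldl-preserves-Dependent ord ∘ step-preserves-Dependent z

  foldl-decides : ∀ {z} ord → z ∈ₗ ord → z ∈ foldl step X ord ⊎ ¬ Accepts φ (foldl step X ord) z
  foldl-decides (z ∷ ord) (there z∈ord) = foldl-decides ord z∈ord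
  foldl-decides (z ∷ ord) (here refl) with step-decides z
  ... | inj₁ z∈step   = inj₁ (⊆-foldl ord z∈step)
  ... | inj₂ rejected = inj₂ (rejected ∘ Accepts-antitone φ (⊆-foldl ord ∘ ⊆-step z))

theorem5 : ∀ {n} (φ : LTL n) (O : Subset n)
    (isDependent : Fin n → Subset n → Bool) →
    (∀ z Y → (isDependent z Y ≡ true) ⇔ DependentOn φ ⁅ z ⁆ Y) →
    (ord : List (Fin n)) → Unique ord → (∀ z → (z ∈ O) ⇔ (z ∈ₗ ord)) →
    MaximalDependent φ O (findDependent isDependent ord)
theorem5 φ O isDependent isDependent-correct ord _ O⇔ord =
  result⊆O , foldl-preserves-Dependent ord (DependentOn-⊥ φ) , maximal
  where
  open FindDependent φ isDependent isDependent-correct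
  result : Subset _
  result = findDependent isDependent ord

  result⊆O : result ⊆ O
  result⊆O x∈ = [ ⊥-elim ∘ ∉⊥ , Equivalence.from (O⇔ord _) ] (foldl-⊆ ord x∈)

  maximal : ∀ X' → X' ⊆ O → result ⊂ X' → ¬ Dependent φ X'
  maximal X' X'⊆O (result⊆X' , z , z∈X' , z∉result) depX'
    with foldl-decides ord (Equivalence.to (O⇔ord z) (X'⊆O z∈X'))
  ... | inj₁ z∈result = z∉result z∈result
  ... | inj₂ rejected = rejected (Dependent⇒Accepts φ depX' result⊆X' z∈X')
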